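{- Let $X$ be a finite set, $\alpha:X\to X$ a bijection and $E\subseteq X$ with $(X,\alpha)$ $E$-bound. Let $\widehat X=X\times\{ -1,1\}$, $\widehat E=E\times\{1\}\sqcup E\times\{ -1\}$, $\widehat\alpha(i,s)=(\alpha^s i,s)$, $r(i,s)=(i,-s)$; then $(\widehat X,\widehat\alpha,r)$ is reversible and $\widehat E$-bound, and we consider the system $(\widehat X,[0,\widehat L],\widehat e,\widehat\alpha,r)$. Then: (a) $\widehat E$ is $r$-invariant; $\widehat E$ is $s$-stable (for $\widehat\alpha$) if and only if $E$ is $s$-stable (for $\alpha$); $\widehat L=\max_{i\in X}e(i)=\max_{i\in X}e_{ -1}(i)=L$; and $\widehat X_k=(X_k\times\{1\})\sqcup(X_{ -k}\times\{ -1\})$ with $|\widehat X_k|=2|X_k|$. (b) If $(i_{k+1},s)\to(i_k,s)\to\cdots\to(i_0,s)$ is an $\widehat\alpha$-path (i.e. $\widehat\alpha(i_{u+1},s)=(i_u,s)$) with $(i_0,s),(i_{k+1},s)\in\widehat E$ and $(i_u,s)\in\widehat X\setminus\widehat E$ for $u\in[1,k]$, then for $u\in[1,k]$: $S(r(i_u,s))=S(i_u,s)$ if and only if $|X_u|=|X_{k-u+1}|$. (c) $e(\alpha(E))=[0,L]$ if and only if $\widehat e(\widehat\alpha(\widehat E))=[0,L]$. (d) Assume $e(\alpha(E))=[0,L]$. Then $\widehat X^{\mathrm{eq}}=\widehat E$, $\widehat X^{\mathrm{neq}}=\widehat X\setminus\widehat E$, $\widehat D=\{x\in\widehat X^{\mathrm{eq}}:\widehat\alpha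 x\in\widehat X^{\mathrm{neq}}\}$, entropy is strictly increasing on $\widehat X^{\mathrm{neq}}$, and $|[\![\widehat X^{\mathrm{eq}},\widehat X_k]\!]|=2(|X_k|-|X_{k+1}|)$ for $k\in[0,L]$. For paths as in (b), $S(r(i_u,s))=S(i_u,s)$ if and only if $u=\frac{k+1}{2}$. Furthermore $\frac{|\widehat D|}{|\widehat X|}=\frac{|D|}{|X|}$, $\frac{|\widehat I|}{|\widehat X|}=\frac{|I|}{|X|}$, $\frac{|\widehat C|}{|\widehat X|}=\frac{|C|}{|X|}$, and $\langle\widehat{\mathcal A}\rangle=\langle\mathcal A\rangle$.
   Context: $(X,\alpha)$ is $E$-bound if every $\alpha$-cycle meets $E$. The $E$-reaching time is $e(i)=$ the smallest $k\ge0$ with $\alpha^k(i)\in E$, $L=\max e$, $X_k=e^{ -1}(k)$, $X_{L+1}=\emptyset$; $e_{ -1}(i)$ is the smallest $k\ge0$ with $\alpha^{ -k}(i)\in E$ and $X_{ -k}=e_{ -1}^{ -1}(k)$. Analogously $\widehat e(x)$ is the smallest $k\ge0$ with $\widehat\alpha^k(x)\in\widehat E$, $\widehat L=\max\widehat e$, $\widehat X_k=\widehat e^{ -1}(k)$. For a system with bijection $\beta$ on microstates $Y$ and reaching-time map $f$ (macrostates $[0,\max f]$), entropy is $S(y)=\ln|f^{ -1}(f(y))|$; $Y^{\mathrm{eq}}$ is the set of microstates in macrostates of maximal size, $Y^{\mathrm{neq}}$ its complement; $D,C,I$ (resp. $\widehat D,\widehat C,\widehat I$) are the sets where $S(\beta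 y)<S(y)$, $=$, $>$ for $(X,[0,L],e,\alpha)$ (resp. $(\widehat X,[0,L],\widehat e,\widehat\alpha)$). $[\![U,V]\!]=\{y\in U:\beta(y)\in V\}$. A set $F$ is $s$-stable for $\beta$ if for every $y\in F\cap\beta(Y\setminus F)$, $\beta^k y\in F$ for $0\le k\le s$. $\mathcal A(y)$ is the largest $N\ge0$ with $S(y)<S(\beta y)<\cdots<S(\beta^N y)$, and $\langle\mathcal A\rangle$, $\langle\widehat{\mathcal A}\rangle$ are its means under the uniform distribution on $X$, resp. $\widehat X$. -}

module Defs where

open import Data.Nat using (ℕ; zero; suc; _≤_; _⊔_; _≡ᵇ_; _<ᵇ_)
open import Data.Bool using (Bool; true; false; if_then_else_; _∧_; not)
open import Data.List using (List; []; _∷_; length; map; foldr; upTo; _++_; allFin)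
open import Data.Nat.ListAction using (sum)
open import Data.Fin using (Fin)
open import Data.Fin.Permutation using (Permutation′; _⟨$⟩ʳ_; _⟨$⟩ˡ_; inverseʳ; inverseˡ)
open import Data.Product using (_×_; _,_; ∃-syntax)
open import Function.Bundles using (_↔_; mk↔ₛ′; Inverse; _⇔_)
open import Relation.Binary.PropositionalEquality using (_≡_; refl; cong)

iter : {A : Set} → (A → A) → ℕ → A → A
iter f zero a = a
iter f (suc k) a = iter f k (f a)

count : {A : Set} → (A → Bool) → List A → ℕ
count p [] = 0
count p (x ∷ xs) = if p x then suc (count p xs) else count p xs

maxList : List ℕ → ℕ
maxList = foldr _⊔_ 0

-- reaching time of the set E under f, computed by search with fuel:
-- rt f E fuel a = least k < fuel with E (f^k a), (0 if none is found).
rt : {A : Set} → (A → A) → (A → Bool) → ℕ → A → ℕ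
rt f E zero a = 0
rt f E (suc fuel) a = if E a then 0 else suc (rt f E fuel (f a))

-- A system: a finite set of microstates A, enumerated without repetition by
-- `el` (for the concrete instances below this is by construction), a
-- bijection β on A, and a distinguished subset E (Boolean predicate).
record Sys : Set₁ where
  field
    A  : Set
    el : List A
    β  : A ↔ A
    E  : A → Bool

module _ (𝒮 : Sys) where
  open Sys 𝒮
  private
    b : A → A
    b = Inverse.to β

  card : ℕ
  card = length el

  Bound : Set
  Bound = ∀ a → ∃[ k ] E (iter b k a) ≡ true

  Stable : ℕ → Set
  Stable s = ∀ y z → b z ≡ y → E z ≡ false → E y ≡ true →
             ∀ k → k ≤ s → E (iter b k y) ≡ true

  -- E-reaching time e(a) = least k ≥ 0 with β^k a ∈ E
  -- (the search fuel |A| suffices for E-bound systems)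
  e : A → ℕ
  e = rt b E card

  Lmax : ℕ
  Lmax = maxList (map e el)

  inMacro : ℕ → A → Bool
  inMacro k a = e a ≡ᵇ k

  size : ℕ → ℕ
  size k = count (inMacro k) el

  -- |f⁻¹(f(y))|; the entropy is S(y) = ln (msize y), and ln is strictly
  -- increasing, so comparisons of S are comparisons of msize.
  msize : A → ℕ
  msize y = size (e y)

  maxSize : ℕ
  maxSize = maxList (map size (upTo (suc Lmax)))

  Eq : A → Bool
  Eq y = msize y ≡ᵇ maxSize

  Neq : A → Bool
  Neq y = not (Eq y)

  Dset : A → Bool
  Dset y = msize (b y) <ᵇ msize y

  Cset : A → Bool
  Cset y = msize (b y) ≡ᵇ msize y

  Iset : A → Bool
  Iset y = msize y <ᵇ msize (b y)

  -- |[[U , V]]| = |{ y ∈ U : β y ∈ V }|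
  pairCount : (A → Bool) → (A → Bool) → ℕ
  pairCount U V = count (λ y → U y ∧ V (b y)) el

  -- 𝒜(y): largest N ≥ 0 with S(y) < S(βy) < ... < S(β^N y)
  -- (computed greedily; strictly increasing chains of sizes in [1,|A|] have
  --  length < |A|, so the fuel |A|+1 suffices)
  asc : ℕ → A → ℕ
  asc zero y = 0
  asc (suc fuel) y = if msize y <ᵇ msize (b y) then suc (asc fuel (b y)) else 0

  𝒜 : A → ℕ
  𝒜 = asc (suc card)

  -- Σ_y 𝒜(y); the mean ⟨𝒜⟩ is this divided by |A|
  sum𝒜 : ℕ
  sum𝒜 = sum (map 𝒜 el)

  ImageRange : ℕ → Set
  ImageRange M = ∀ k → (k ≤ M ⇔ (∃[ a ] (E a ≡ true × e (b a) ≡ k)))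

sysX : (n : ℕ) → Permutation′ n → (Fin n → Bool) → Sys
sysX n π E = record { A = Fin n ; el = allFin n ; β = π ; E = E }

invPerm : {n : ℕ} → Permutation′ n → Permutation′ n
invPerm π = mk↔ₛ′ (π ⟨$⟩ˡ_) (π ⟨$⟩ʳ_) (λ y → inverseˡ π) (λ y → inverseʳ π)

-- (X, α⁻¹, E): its reaching time is e₋₁ and its level sets are X₋ₖ
sysXinv : (n : ℕ) → Permutation′ n → (Fin n → Bool) → Sys
sysXinv n π E = sysX n (invPerm π) E

-- X̂ = X × {-1, 1}, with the sign 1 encoded as true and -1 as false
Hat : ℕ → Set
Hat n = Fin n × Bool

hatEl : (n : ℕ) → List (Hat n)
hatEl n = map (λ i → (i , true)) (allFin n) ++ map (λ i → (i , false)) (allFin n)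

hatαfun : {n : ℕ} → Permutation′ n → Hat n → Hat n
hatαfun π (i , true) = (π ⟨$⟩ʳ i , true)
hatαfun π (i , false) = (π ⟨$⟩ˡ i , false)

hatαinv : {n : ℕ} → Permutation′ n → Hat n → Hat n
hatαinv π (i , true) = (π ⟨$⟩ˡ i , true)
hatαinv π (i , false) = (π ⟨$⟩ʳ i , false)

hatα : {n : ℕ} → Permutation′ n → Hat n ↔ Hat n
hatα π = mk↔ₛ′ (hatαfun π) (hatαinv π) invl invr
  where
  invl : ∀ y → hatαfun π (hatαinv π y) ≡ y
  invl (i , true) = cong (_, true) (inverseʳ π)
  invl (i , false) = cong (_, false) (inverseˡ π)
  invr : ∀ y → hatαinv π (hatαfun π y) ≡ y
  invr (i , true) = cong (_, true) (inverseˡ π)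
  invr (i , false) = cong (_, false) (inverseʳ π)

hatE : {n : ℕ} → (Fin n → Bool) → Hat n → Bool
hatE E (i , s) = E i

r : {n : ℕ} → Hat n → Hat n
r (i , s) = (i , not s)

sysHat : (n : ℕ) → Permutation′ n → (Fin n → Bool) → Sys
sysHat n π E = record { A = Hat n ; el = hatEl n ; β = hatα π ; E = hatE E }

Reversible : {A : Set} → (A ↔ A) → (A → A) → Set
Reversible β ρ = (∀ x → ρ (ρ x) ≡ x) × (∀ x → ρ (Inverse.to β (ρ x)) ≡ Inverse.from β x)

-- an α̂-path (i_{k+1}, s) → (i_k, s) → ⋯ → (i_0, s) with (i_0,s), (i_{k+1},s) ∈ Ê
-- and (i_u, s) ∉ Ê for u ∈ [1, k]  (the sequence i is indexed by ℕ; only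
-- the values i 0 , … , i (k+1) matter)
HatPath : {n : ℕ} → Permutation′ n → (Fin n → Bool) → Bool → ℕ → (ℕ → Fin n) → Set
HatPath π E s k i =
    (∀ u → u ≤ k → hatαfun π (i (suc u) , s) ≡ (i u , s))
  × hatE E (i 0 , s) ≡ true
  × hatE E (i (suc k) , s) ≡ true
  × (∀ u → 1 ≤ u → u ≤ k → hatE E (i u , s) ≡ false)

-- The reaching time of (i, 1) in X̂ is e(i) and that of (i, −1) is e₋₁(i). The two
-- reaching times have macrostates of the same sizes: e(y) > k and e₋₁(αᵏ y) > k both say
-- that y, αy, …, αᵏ y avoid E, so αᵏ maps {e > k} bijectively onto {e₋₁ > k}. Hence
-- |X̂ₖ| = 2|Xₖ|, Σ e = Σₖ |{e > k}| = Σ e₋₁, and every count in (a)–(d) splits into an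
-- X-part and an X₋₁-part which agree. If e(α(E)) = [0, L], the decomposition
-- |Xₖ| = |[[E, Xₖ]]| + |Xₖ₊₁| makes k ↦ |Xₖ| strictly decreasing on [0, L]. Entropy is
-- then a strictly decreasing function of the reaching time, which drops by one at every
-- step outside E; this determines the equilibrium set (it is Ê), the sets D, C, I, and
-- 𝒜 (it is ê).
module Submission where

open import Defs
open import Data.Bool using (Bool; true; false; not; _∧_; if_then_else_)
open import Data.Bool.Properties using (∧-comm; ∧-zeroʳ; ∧-identityʳ; not-injective; not-involutive; T-≡; ⇔→≡)
open import Data.Fin using (Fin; zero; suc; toℕ)
open import Data.Fin.Properties using (pigeonhole; toℕ<n)
open import Data.Fin.Permutation using (Permutation′; _⟨$⟩ʳ_; _⟨$⟩ˡ_; inverseʳ; inverseˡ)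
open import Data.List using ([]; _∷_; _++_; map; allFin; tabulate)
open import Data.List.Membership.Propositional using (_∈_)
open import Data.List.Membership.Propositional.Properties using (∈-allFin; ∈-map⁺; ∈-++⁺ˡ; ∈-++⁺ʳ)
open import Data.List.Properties using (map-++; map-∘; map-cong; map-tabulate; length-++; length-map; length-tabulate; foldr-preservesᵇ; foldr-preservesᵒ)
open import Data.List.Relation.Unary.All as All using (All)
open import Data.List.Relation.Unary.All.Properties using (applyUpTo⁺₁; map⁺)
open import Data.List.Relation.Unary.Any as Any using (here; there)
open import Data.Nat using (ℕ; NonZero; zero; suc; _+_; _*_; _∸_; _≤_; _<_; _≡ᵇ_; _<ᵇ_; _≤ᵇ_; z≤n; s≤s; z<s)
open import Data.Nat.DivMod using (_%_; _/_; m≡m%n+[m/n]*n; m%n<n)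
open import Data.Nat.ListAction using (sum)
open import Data.Nat.ListAction.Properties using (sum-++)
open import Data.Nat.Properties
open import Algebra.Properties.CommutativeMonoid.Sum +-0-commutativeMonoid
  using (sum-syntax; sum-cong-≗; sum-permute; sum-replicate-zero; ∑-distrib-+; ∑-comm)
open import Data.Product using (_×_; _,_; proj₁; proj₂; ∃-syntax)
open import Data.Sum using (_⊎_; inj₁; inj₂)
open import Function using (_∘_; id)
open import Function.Bundles using (_⇔_; mk⇔; mk↔ₛ′; Inverse; Equivalence)
open import Function.Construct.Composition using (_⇔-∘_)
open import Function.Construct.Symmetry using (⇔-sym)
open import Relation.Binary using (tri<; tri≈; tri>)
open import Relation.Binary.PropositionalEquality
open import Relation.Nullary using (yes; no; contradiction)

open ≡-Reasoning

<⇒<ᵇ≡true : ∀ {m n} → m < n → (m <ᵇ n) ≡ true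
<⇒<ᵇ≡true m<n = Equivalence.to T-≡ (<⇒<ᵇ m<n)

<ᵇ≡true⇒< : ∀ {m n} → (m <ᵇ n) ≡ true → m < n
<ᵇ≡true⇒< {m} {n} m<ᵇn = <ᵇ⇒< m n (Equivalence.from T-≡ m<ᵇn)

≤⇒<ᵇ≡false : ∀ {m n} → n ≤ m → (m <ᵇ n) ≡ false
≤⇒<ᵇ≡false z≤n       = refl
≤⇒<ᵇ≡false (s≤s n≤m) = ≤⇒<ᵇ≡false n≤m

≡⇒≡ᵇ≡true : ∀ {m n} → m ≡ n → (m ≡ᵇ n) ≡ true
≡⇒≡ᵇ≡true {m} {n} m≡n = Equivalence.to T-≡ (≡⇒≡ᵇ m n m≡n)

n<ᵇn≡false : ∀ n → (n <ᵇ n) ≡ false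
n<ᵇn≡false n = ≤⇒<ᵇ≡false (≤-refl {n})

n≡ᵇn≡true : ∀ n → (n ≡ᵇ n) ≡ true
n≡ᵇn≡true n = ≡⇒≡ᵇ≡true {n} refl

≢⇒≡ᵇ≡false : ∀ {m n} → m ≢ n → (m ≡ᵇ n) ≡ false
≢⇒≡ᵇ≡false {m} {n} m≢n with m ≡ᵇ n in m≡ᵇn
... | true  = contradiction (≡ᵇ⇒≡ m n (Equivalence.from T-≡ m≡ᵇn)) m≢n
... | false = refl

<ᵇ-cong : ∀ {a b c d} → (a < b ⇔ c < d) → (a <ᵇ b) ≡ (c <ᵇ d)
<ᵇ-cong a<b⇔c<d = ⇔→≡ {z = true} (mk⇔
  (<⇒<ᵇ≡true ∘ Equivalence.to a<b⇔c<d ∘ <ᵇ≡true⇒<)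
  (<⇒<ᵇ≡true ∘ Equivalence.from a<b⇔c<d ∘ <ᵇ≡true⇒<))

m+m≡2*m : ∀ m → m + m ≡ 2 * m
m+m≡2*m m = cong (m +_) (sym (+-identityʳ m))

u+[k∸u+1]≡k+1 : ∀ {u k} → u ≤ k → u + (k ∸ u + 1) ≡ k + 1
u+[k∸u+1]≡k+1 {u} {k} u≤k = trans (sym (+-assoc u (k ∸ u) 1)) (cong (_+ 1) (m+[n∸m]≡n u≤k))

midpoint : ∀ {u k} → u ≤ k → u ≡ k ∸ u + 1 ⇔ 2 * u ≡ k + 1
midpoint {u} {k} u≤k = mk⇔
  (λ u≡ → trans (sym (m+m≡2*m u)) (trans (cong (u +_) u≡) (u+[k∸u+1]≡k+1 u≤k)))
  (λ 2u≡ → +-cancelˡ-≡ u u (k ∸ u + 1) (trans (m+m≡2*m u) (trans 2u≡ (sym (u+[k∸u+1]≡k+1 u≤k)))))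

decreasing-from-steps : ∀ {φ : ℕ → ℕ} {L} → (∀ k → suc k ≤ L → φ (suc k) < φ k) →
                        ∀ j k → j < k → k ≤ L → φ k < φ j
decreasing-from-steps shrinks j (suc k) j<1+k 1+k≤L with m≤n⇒m<n∨m≡n (≤-pred j<1+k)
... | inj₁ j<k  = <-trans (shrinks k 1+k≤L) (decreasing-from-steps shrinks j k j<k (≤-trans (n≤1+n k) 1+k≤L))
... | inj₂ refl = shrinks k 1+k≤L

module _ {φ : ℕ → ℕ} {L : ℕ} (decreasing : ∀ j k → j < k → k ≤ L → φ k < φ j) where

  antitone-injective : ∀ {j k} → j ≤ L → k ≤ L → φ j ≡ φ k → j ≡ k
  antitone-injective {j} {k} j≤L k≤L φj≡φk with <-cmp j k
  ... | tri< j<k _ _ = contradiction (sym φj≡φk) (<⇒≢ (decreasing j k j<k k≤L))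
  ... | tri≈ _ j≡k _ = j≡k
  ... | tri> _ _ k<j = contradiction φj≡φk (<⇒≢ (decreasing k j k<j j≤L))

  antitone-<ᵇ : ∀ {j k} → j ≤ L → k ≤ L → (φ j <ᵇ φ k) ≡ (k <ᵇ j)
  antitone-<ᵇ {j} {k} j≤L k≤L with <-cmp j k
  ... | tri< j<k _ _  = trans (≤⇒<ᵇ≡false (<⇒≤ (decreasing j k j<k k≤L))) (sym (≤⇒<ᵇ≡false (<⇒≤ j<k)))
  ... | tri≈ _ refl _ = trans (n<ᵇn≡false (φ j)) (sym (n<ᵇn≡false j))
  ... | tri> _ _ k<j  = trans (<⇒<ᵇ≡true (decreasing k j k<j j≤L)) (sym (<⇒<ᵇ≡true k<j))

  antitone-≡ᵇ : ∀ {j k} → j ≤ L → k ≤ L → (φ j ≡ᵇ φ k) ≡ (j ≡ᵇ k)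
  antitone-≡ᵇ {j} {k} j≤L k≤L with j ≟ k
  ... | yes refl = trans (n≡ᵇn≡true (φ j)) (sym (n≡ᵇn≡true j))
  ... | no j≢k   = trans (≢⇒≡ᵇ≡false (j≢k ∘ antitone-injective j≤L k≤L)) (sym (≢⇒≡ᵇ≡false j≢k))

module _ {A : Set} (f : A → A) where

  iter-+ : ∀ m k x → iter f (m + k) x ≡ iter f k (iter f m x)
  iter-+ zero    k x = refl
  iter-+ (suc m) k x = iter-+ m k (f x)

  iter-suc : ∀ k x → iter f (suc k) x ≡ f (iter f k x)
  iter-suc zero    x = refl
  iter-suc (suc k) x = iter-suc k (f x)

  iter-* : ∀ {p x} → iter f p x ≡ x → ∀ q → iter f (q * p) x ≡ x
  iter-* periodic zero    = refl
  iter-* {p} {x} periodic (suc q) = begin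
    iter f (p + q * p) x         ≡⟨ iter-+ p (q * p) x ⟩
    iter f (q * p) (iter f p x)  ≡⟨ cong (iter f (q * p)) periodic ⟩
    iter f (q * p) x             ≡⟨ iter-* periodic q ⟩
    x                            ∎

  iter-mod : ∀ {p x} .{{_ : NonZero p}} → iter f p x ≡ x → ∀ k → iter f k x ≡ iter f (k % p) x
  iter-mod {p} {x} periodic k = begin
    iter f k x                                  ≡⟨ cong (λ m → iter f m x) (m≡m%n+[m/n]*n k p) ⟩
    iter f (k % p + k / p * p) x                ≡⟨ cong (λ m → iter f m x) (+-comm (k % p) (k / p * p)) ⟩
    iter f (k / p * p + k % p) x                ≡⟨ iter-+ (k / p * p) (k % p) x ⟩
    iter f (k % p) (iter f (k / p * p) x)       ≡⟨ cong (iter f (k % p)) (iter-* periodic (k / p)) ⟩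
    iter f (k % p) x                            ∎

  module _ {g : A → A} (g∘f : ∀ x → g (f x) ≡ x) where

    iter-cancel : ∀ k x → iter g k (iter f k x) ≡ x
    iter-cancel zero    x = refl
    iter-cancel (suc k) x = begin
      iter g k (g (iter f (suc k) x))  ≡⟨ cong (iter g k ∘ g) (iter-suc k x) ⟩
      iter g k (g (f (iter f k x)))    ≡⟨ cong (iter g k) (g∘f (iter f k x)) ⟩
      iter g k (iter f k x)            ≡⟨ iter-cancel k x ⟩
      x                                ∎

    iter-injective : ∀ k {x y} → iter f k x ≡ iter f k y → x ≡ y
    iter-injective k {x} {y} same =
      trans (sym (iter-cancel k x)) (trans (cong (iter g k) same) (iter-cancel k y))

    iter-∸ : ∀ {j k} x → j ≤ k → iter g j (iter f k x) ≡ iter f (k ∸ j) x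
    iter-∸ {j} {k} x j≤k = begin
      iter g j (iter f k x)                  ≡⟨ cong (λ m → iter g j (iter f m x)) (m∸n+n≡m j≤k) ⟨
      iter g j (iter f (k ∸ j + j) x)        ≡⟨ cong (iter g j) (iter-+ (k ∸ j) j x) ⟩
      iter g j (iter f j (iter f (k ∸ j) x)) ≡⟨ iter-cancel j _ ⟩
      iter f (k ∸ j) x                       ∎

-- Reaching times by bounded search

module _ {A : Set} (f : A → A) (E : A → Bool) where

  rt-least : ∀ fuel a {j} → j < rt f E fuel a → E (iter f j a) ≡ false
  rt-least (suc fuel) a {zero} 0<rt with E a
  ... | false = refl
  rt-least (suc fuel) a {suc j} j+1<rt with E a
  ... | false = rt-least fuel (f a) (≤-pred j+1<rt)

  rt-hit : ∀ fuel a {k} → E (iter f k a) ≡ true → k < fuel →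
           rt f E fuel a ≤ k × E (iter f (rt f E fuel a) a) ≡ true
  rt-hit (suc fuel) a {k} hit k<fuel with E a in Ea
  ... | true = z≤n , Ea
  rt-hit (suc fuel) a {zero}  hit k<fuel | false = contradiction (trans (sym hit) Ea) λ ()
  rt-hit (suc fuel) a {suc k} hit k<fuel | false =
    let rt≤k , rt-hits = rt-hit fuel (f a) hit (≤-pred k<fuel) in s≤s rt≤k , rt-hits

step : (𝒮 : Sys) → Sys.A 𝒮 → Sys.A 𝒮
step 𝒮 = Inverse.to (Sys.β 𝒮)

-- `e` searches only |A| steps ahead
HitsWithinCard : Sys → Set
HitsWithinCard 𝒮 = ∀ a → ∃[ k ] (k < card 𝒮 × Sys.E 𝒮 (iter (step 𝒮) k a) ≡ true)

SizesDecrease : Sys → Set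
SizesDecrease 𝒮 = ∀ j k → j < k → k ≤ Lmax 𝒮 → size 𝒮 k < size 𝒮 j

maxList-≤ : ∀ {c xs} → All (_≤ c) xs → maxList xs ≤ c
maxList-≤ = foldr-preservesᵇ ⊔-lub z≤n

≤-maxList : ∀ {x xs} → x ∈ xs → x ≤ maxList xs
≤-maxList {x} {xs} x∈xs = foldr-preservesᵒ
  (λ m n → λ { (inj₁ x≤m) → m≤n⇒m≤n⊔o n x≤m ; (inj₂ x≤n) → m≤n⇒m≤o⊔n m x≤n })
  0 xs (inj₂ (Any.map ≤-reflexive x∈xs))

module _ (𝒮 : Sys) where

  Lmax-lub : ∀ {c} → (∀ a → e 𝒮 a ≤ c) → Lmax 𝒮 ≤ c
  Lmax-lub e≤c = maxList-≤ (map⁺ (All.universal e≤c (Sys.el 𝒮)))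

  e≤Lmax : ∀ {a} → a ∈ Sys.el 𝒮 → e 𝒮 a ≤ Lmax 𝒮
  e≤Lmax a∈el = ≤-maxList (∈-map⁺ (e 𝒮) a∈el)

module ReachingTime (𝒮 : Sys) (hits : HitsWithinCard 𝒮) where

  open Sys 𝒮 using (E)

  private
    next = step 𝒮

  e<card : ∀ a → e 𝒮 a < card 𝒮
  e<card a = let k , k<card , hit = hits a in
    ≤-<-trans (proj₁ (rt-hit next E (card 𝒮) a hit k<card)) k<card

  e-reaches : ∀ a → E (iter next (e 𝒮 a) a) ≡ true
  e-reaches a = let k , k<card , hit = hits a in proj₂ (rt-hit next E (card 𝒮) a hit k<card)

  e-least : ∀ a {j} → j < e 𝒮 a → E (iter next j a) ≡ false
  e-least = rt-least next E (card 𝒮)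

  e-unique : ∀ a {k} → E (iter next k a) ≡ true → (∀ j → j < k → E (iter next j a) ≡ false) →
             e 𝒮 a ≡ k
  e-unique a {k} hit before with <-cmp (e 𝒮 a) k
  ... | tri< e<k _ _ = contradiction (trans (sym (e-reaches a)) (before _ e<k)) λ ()
  ... | tri≈ _ e≡k _ = e≡k
  ... | tri> _ _ k<e = contradiction (trans (sym hit) (e-least a k<e)) λ ()

  E⇒e≡0 : ∀ {a} → E a ≡ true → e 𝒮 a ≡ 0
  E⇒e≡0 Ea = e-unique _ Ea λ _ ()

  e-step : ∀ {a} → E a ≡ false → e 𝒮 a ≡ suc (e 𝒮 (next a))
  e-step {a} Ea = e-unique a (e-reaches (next a)) before
    where
    before : ∀ j → j < suc (e 𝒮 (next a)) → E (iter next j a) ≡ false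
    before zero    _      = Ea
    before (suc j) j+1<e+1 = e-least (next a) (≤-pred j+1<e+1)

  e≡ᵇ0 : ∀ a → (e 𝒮 a ≡ᵇ 0) ≡ E a
  e≡ᵇ0 a with E a in Ea
  ... | true  rewrite E⇒e≡0 Ea = refl
  ... | false rewrite e-step Ea = refl

  <e⇔avoids : ∀ {a k} → k < e 𝒮 a ⇔ (∀ j → j ≤ k → E (iter next j a) ≡ false)
  <e⇔avoids {a} {k} = mk⇔
    (λ k<e j j≤k → e-least a (≤-<-trans j≤k k<e))
    (λ avoids → ≰⇒> λ e≤k → contradiction (trans (sym (e-reaches a)) (avoids _ e≤k)) λ ())

  e<ᵇe∘step : ∀ a → (e 𝒮 a <ᵇ e 𝒮 (next a)) ≡ E a ∧ not (E (next a))
  e<ᵇe∘step a with E a in Ea | E (next a) in Ena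
  ... | true  | true  rewrite E⇒e≡0 Ea | E⇒e≡0 Ena = refl
  ... | true  | false rewrite E⇒e≡0 Ea | e-step Ena = refl
  ... | false | _     rewrite e-step Ea = ≤⇒<ᵇ≡false (n≤1+n (e 𝒮 (next a)))

  e∘step<ᵇe : ∀ a → (e 𝒮 (next a) <ᵇ e 𝒮 a) ≡ not (E a)
  e∘step<ᵇe a with E a in Ea
  ... | true  rewrite E⇒e≡0 Ea = refl
  ... | false rewrite e-step Ea = <⇒<ᵇ≡true (n<1+n (e 𝒮 (next a)))

  e∘step≡ᵇe : ∀ a → (e 𝒮 (next a) ≡ᵇ e 𝒮 a) ≡ E a ∧ E (next a)
  e∘step≡ᵇe a with E a in Ea | E (next a) in Ena
  ... | true  | true  rewrite E⇒e≡0 Ea | E⇒e≡0 Ena = refl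
  ... | true  | false rewrite E⇒e≡0 Ea | e-step Ena = refl
  ... | false | _     rewrite e-step Ea = ≢⇒≡ᵇ≡false {e 𝒮 (next a)} (1+n≢n ∘ sym)

  module Entropy (complete : ∀ a → a ∈ Sys.el 𝒮) (decreasing : SizesDecrease 𝒮) where

    private
      e≤L : ∀ a → e 𝒮 a ≤ Lmax 𝒮
      e≤L a = e≤Lmax 𝒮 (complete a)

    msize-<ᵇ : ∀ a b → (msize 𝒮 a <ᵇ msize 𝒮 b) ≡ (e 𝒮 b <ᵇ e 𝒮 a)
    msize-<ᵇ a b = antitone-<ᵇ decreasing (e≤L a) (e≤L b)

    maxSize≡size0 : maxSize 𝒮 ≡ size 𝒮 0
    maxSize≡size0 = m≥n⇒m⊔n≡m (maxList-≤ (map⁺ (applyUpTo⁺₁ suc (Lmax 𝒮)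
      (λ j<L → <⇒≤ (decreasing 0 _ z<s j<L)))))

    Eq≡E : ∀ a → Eq 𝒮 a ≡ E a
    Eq≡E a = begin
      (msize 𝒮 a ≡ᵇ maxSize 𝒮)   ≡⟨ cong (msize 𝒮 a ≡ᵇ_) maxSize≡size0 ⟩
      (msize 𝒮 a ≡ᵇ size 𝒮 0)    ≡⟨ antitone-≡ᵇ decreasing (e≤L a) z≤n ⟩
      (e 𝒮 a ≡ᵇ 0)               ≡⟨ e≡ᵇ0 a ⟩
      E a                        ∎

    Dset≡ : ∀ a → Dset 𝒮 a ≡ E a ∧ not (E (next a))
    Dset≡ a = trans (msize-<ᵇ (next a) a) (e<ᵇe∘step a)

    Iset≡ : ∀ a → Iset 𝒮 a ≡ not (E a)
    Iset≡ a = trans (msize-<ᵇ a (next a)) (e∘step<ᵇe a)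

    Cset≡ : ∀ a → Cset 𝒮 a ≡ E a ∧ E (next a)
    Cset≡ a = trans (antitone-≡ᵇ decreasing (e≤L (next a)) (e≤L a)) (e∘step≡ᵇe a)

    msize-increasing : ∀ {a} → E a ≡ false → msize 𝒮 a < msize 𝒮 (next a)
    msize-increasing {a} Ea = subst (λ k → size 𝒮 k < msize 𝒮 (next a)) (sym (e-step Ea))
      (decreasing _ _ ≤-refl (subst (_≤ Lmax 𝒮) (e-step Ea) (e≤L a)))

    asc≡e : ∀ fuel a → e 𝒮 a < fuel → asc 𝒮 fuel a ≡ e 𝒮 a
    asc≡e (suc fuel) a e<fuel with E a in Ea
    ... | true = begin
      asc 𝒮 (suc fuel) a  ≡⟨ cong (λ b → if b then suc (asc 𝒮 fuel (next a)) else 0) (trans (Iset≡ a) (cong not Ea)) ⟩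
      0                   ≡⟨ E⇒e≡0 Ea ⟨
      e 𝒮 a               ∎
    ... | false = begin
      asc 𝒮 (suc fuel) a         ≡⟨ cong (λ b → if b then suc (asc 𝒮 fuel (next a)) else 0) (trans (Iset≡ a) (cong not Ea)) ⟩
      suc (asc 𝒮 fuel (next a))  ≡⟨ cong suc (asc≡e fuel (next a) (≤-pred (subst (_< suc fuel) (e-step Ea) e<fuel))) ⟩
      suc (e 𝒮 (next a))         ≡⟨ e-step Ea ⟨
      e 𝒮 a                      ∎

    𝒜≡e : ∀ a → 𝒜 𝒮 a ≡ e 𝒮 a
    𝒜≡e a = asc≡e (suc (card 𝒮)) a (m<n⇒m<1+n (e<card a))

-- Counting

𝟙 : Bool → ℕ
𝟙 b = if b then 1 else 0

𝟙-split : ∀ a b → 𝟙 (a ∧ b) + 𝟙 (a ∧ not b) ≡ 𝟙 a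
𝟙-split true  true  = refl
𝟙-split true  false = refl
𝟙-split false _     = refl

𝟙-≡ᵇ+<ᵇ : ∀ m k → 𝟙 (m ≡ᵇ k) + 𝟙 (k <ᵇ m) ≡ 𝟙 (k ≤ᵇ m)
𝟙-≡ᵇ+<ᵇ zero    zero          = refl
𝟙-≡ᵇ+<ᵇ zero    (suc k)       = refl
𝟙-≡ᵇ+<ᵇ (suc m) zero          = refl
𝟙-≡ᵇ+<ᵇ (suc m) (suc zero)    = 𝟙-≡ᵇ+<ᵇ m zero
𝟙-≡ᵇ+<ᵇ (suc m) (suc (suc k)) = 𝟙-≡ᵇ+<ᵇ m (suc k)

count≡sum-map : ∀ {A : Set} (p : A → Bool) xs → count p xs ≡ sum (map (𝟙 ∘ p) xs)
count≡sum-map p []       = refl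
count≡sum-map p (x ∷ xs) with p x
... | true  = cong suc (count≡sum-map p xs)
... | false = count≡sum-map p xs

count-cong : ∀ {A : Set} {p q : A → Bool} → (∀ a → p a ≡ q a) → ∀ xs → count p xs ≡ count q xs
count-cong {p = p} {q} p≗q xs = begin
  count p xs             ≡⟨ count≡sum-map p xs ⟩
  sum (map (𝟙 ∘ p) xs)   ≡⟨ cong sum (map-cong (cong 𝟙 ∘ p≗q) xs) ⟩
  sum (map (𝟙 ∘ q) xs)   ≡⟨ count≡sum-map q xs ⟨
  count q xs             ∎

count-pos : ∀ {A : Set} {p : A → Bool} {x xs} → x ∈ xs → p x ≡ true → 0 < count p xs
count-pos {p = p} (here refl) px rewrite px = z<s
count-pos {p = p} {xs = y ∷ _} (there x∈xs) px with p y
... | true  = z<s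
... | false = count-pos x∈xs px

sum-map-allFin : ∀ {n} (h : Fin n → ℕ) → sum (map h (allFin n)) ≡ ∑[ i < n ] h i
sum-map-allFin h = trans (cong sum (map-tabulate id h)) (sum-tabulate h)
  where
  sum-tabulate : ∀ {n} (h : Fin n → ℕ) → sum (tabulate h) ≡ ∑[ i < n ] h i
  sum-tabulate {zero}  h = refl
  sum-tabulate {suc n} h = cong (h zero +_) (sum-tabulate (h ∘ suc))

count-allFin : ∀ {n} (p : Fin n → Bool) → count p (allFin n) ≡ ∑[ i < n ] 𝟙 (p i)
count-allFin p = trans (count≡sum-map p (allFin _)) (sum-map-allFin (𝟙 ∘ p))

module _ {n : ℕ} where

  count-permute : ∀ (σ : Permutation′ n) p → count p (allFin n) ≡ count (p ∘ (σ ⟨$⟩ʳ_)) (allFin n)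
  count-permute σ p = begin
    count p (allFin n)               ≡⟨ count-allFin p ⟩
    ∑[ i < n ] 𝟙 (p i)               ≡⟨ sum-permute (𝟙 ∘ p) σ ⟩
    ∑[ i < n ] 𝟙 (p (σ ⟨$⟩ʳ i))      ≡⟨ count-allFin (p ∘ (σ ⟨$⟩ʳ_)) ⟨
    count (p ∘ (σ ⟨$⟩ʳ_)) (allFin n) ∎

  count-+ : ∀ (p q r : Fin n → Bool) → (∀ i → 𝟙 (p i) + 𝟙 (q i) ≡ 𝟙 (r i)) →
            count p (allFin n) + count q (allFin n) ≡ count r (allFin n)
  count-+ p q r pointwise = begin
    count p (allFin n) + count q (allFin n)   ≡⟨ cong₂ _+_ (count-allFin p) (count-allFin q) ⟩
    ∑[ i < n ] 𝟙 (p i) + ∑[ i < n ] 𝟙 (q i)   ≡⟨ ∑-distrib-+ (𝟙 ∘ p) (𝟙 ∘ q) ⟨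
    ∑[ i < n ] (𝟙 (p i) + 𝟙 (q i))            ≡⟨ sum-cong-≗ pointwise ⟩
    ∑[ i < n ] 𝟙 (r i)                        ≡⟨ count-allFin r ⟨
    count r (allFin n)                        ∎

  count-split : ∀ (p q : Fin n → Bool) → count p (allFin n) ≡
                count (λ i → p i ∧ q i) (allFin n) + count (λ i → p i ∧ not (q i)) (allFin n)
  count-split p q = sym (count-+ _ _ p (λ i → 𝟙-split (p i) (q i)))

  count-∧-not-swap : ∀ {p q : Fin n → Bool} → count p (allFin n) ≡ count q (allFin n) →
                     count (λ i → p i ∧ not (q i)) (allFin n) ≡ count (λ i → q i ∧ not (p i)) (allFin n)
  count-∧-not-swap {p} {q} #p≡#q = +-cancelˡ-≡ (count (λ i → p i ∧ q i) (allFin n)) _ _ (begin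
    count (λ i → p i ∧ q i) (allFin n) + count (λ i → p i ∧ not (q i)) (allFin n) ≡⟨ count-split p q ⟨
    count p (allFin n)                                                             ≡⟨ #p≡#q ⟩
    count q (allFin n)                                                             ≡⟨ count-split q p ⟩
    count (λ i → q i ∧ p i) (allFin n) + count (λ i → q i ∧ not (p i)) (allFin n)
      ≡⟨ cong (_+ count (λ i → q i ∧ not (p i)) (allFin n)) (count-cong (λ i → ∧-comm (q i) (p i)) (allFin n)) ⟩
    count (λ i → p i ∧ q i) (allFin n) + count (λ i → q i ∧ not (p i)) (allFin n) ∎)

∑-𝟙-< : ∀ {n m} → m ≤ n → ∑[ k < n ] 𝟙 (toℕ k <ᵇ m) ≡ m
∑-𝟙-< {n}     {zero}  _         = sum-replicate-zero n
∑-𝟙-< {suc n} {suc m} (s≤s m≤n) = cong suc (∑-𝟙-< m≤n)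

layer-cake : ∀ {n m} (h : Fin n → ℕ) → (∀ i → h i ≤ m) →
             sum (map h (allFin n)) ≡ ∑[ k < m ] count (λ i → toℕ k <ᵇ h i) (allFin n)
layer-cake {n} {m} h h≤m = begin
  sum (map h (allFin n))                            ≡⟨ sum-map-allFin h ⟩
  ∑[ i < n ] h i                                    ≡⟨ sum-cong-≗ (λ i → ∑-𝟙-< (h≤m i)) ⟨
  ∑[ i < n ] ∑[ k < m ] 𝟙 (toℕ k <ᵇ h i)            ≡⟨ ∑-comm {n} {m} (λ i k → 𝟙 (toℕ k <ᵇ h i)) ⟩
  ∑[ k < m ] ∑[ i < n ] 𝟙 (toℕ k <ᵇ h i)            ≡⟨ sum-cong-≗ (λ (k : Fin m) → count-allFin (λ i → toℕ k <ᵇ h i)) ⟨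
  ∑[ k < m ] count (λ i → toℕ k <ᵇ h i) (allFin n)  ∎

module _ {n : ℕ} (π : Permutation′ n) where

  private
    α α⁻¹ : Fin n → Fin n
    α   = π ⟨$⟩ʳ_
    α⁻¹ = π ⟨$⟩ˡ_

  orbit-period : ∀ i → ∃[ p ] (0 < p × p ≤ n × iter α p i ≡ i)
  orbit-period i with pigeonhole (n<1+n n) (λ (j : Fin (suc n)) → iter α (toℕ j) i)
  ... | a , b , a<b , same =
    toℕ b ∸ toℕ a , m<n⇒0<n∸m a<b , ≤-trans (m∸n≤m (toℕ b) (toℕ a)) (≤-pred (toℕ<n b)) , periodic
    where
    periodic : iter α (toℕ b ∸ toℕ a) i ≡ i
    periodic = sym (iter-injective α {α⁻¹} (λ _ → inverseˡ π) (toℕ a) (begin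
      iter α (toℕ a) i                          ≡⟨ same ⟩
      iter α (toℕ b) i                          ≡⟨ cong (λ m → iter α m i) (m∸n+n≡m (<⇒≤ a<b)) ⟨
      iter α (toℕ b ∸ toℕ a + toℕ a) i          ≡⟨ iter-+ α (toℕ b ∸ toℕ a) (toℕ a) i ⟩
      iter α (toℕ a) (iter α (toℕ b ∸ toℕ a) i) ∎))

  iterate : ℕ → Permutation′ n
  iterate k = mk↔ₛ′ (iter α k) (iter α⁻¹ k)
    (iter-cancel α⁻¹ (λ _ → inverseʳ π) k) (iter-cancel α (λ _ → inverseˡ π) k)

  count-∧-shift : ∀ (p q : Fin n → Bool) →
    count (λ i → p i ∧ q (α i)) (allFin n) ≡ count (λ i → q i ∧ p (α⁻¹ i)) (allFin n)
  count-∧-shift p q = sym (trans (count-permute π (λ i → q i ∧ p (α⁻¹ i)))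
    (count-cong (λ i → trans (cong (λ j → q (α i) ∧ p j) (inverseˡ π)) (∧-comm (q (α i)) (p i))) (allFin n)))

  exits≡entries : ∀ (E : Fin n → Bool) →
    count (λ i → E i ∧ not (E (α i))) (allFin n) ≡ count (λ i → E i ∧ not (E (α⁻¹ i))) (allFin n)
  exits≡entries E = begin
    count (λ i → E i ∧ not (E (α i))) (allFin n)    ≡⟨ count-∧-shift E (not ∘ E) ⟩
    count (λ i → not (E i) ∧ E (α⁻¹ i)) (allFin n)  ≡⟨ count-cong (λ i → ∧-comm (not (E i)) (E (α⁻¹ i))) (allFin n) ⟩
    count (λ i → E (α⁻¹ i) ∧ not (E i)) (allFin n)  ≡⟨ count-∧-not-swap {p = E ∘ α⁻¹} {q = E} (sym (count-permute (invPerm π) E)) ⟩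
    count (λ i → E i ∧ not (E (α⁻¹ i))) (allFin n)  ∎

  module _ (E : Fin n → Bool) where

    bound⇒hits : Bound (sysX n π E) → HitsWithinCard (sysX n π E)
    bound⇒hits bound i with bound i | orbit-period i
    ... | k , hit | p@(suc _) , _ , p≤n , periodic =
      k % p , <-≤-trans (m%n<n k p) (subst (p ≤_) (sym (length-tabulate id)) p≤n) ,
      trans (cong E (sym (iter-mod α periodic k))) hit

    bound-inverse : Bound (sysX n π E) → Bound (sysXinv n π E)
    bound-inverse bound i with bound i | orbit-period i
    ... | k , hit | p@(suc _) , _ , _ , periodic = j , trans (cong E back) hit
      where
      -- on a p-periodic orbit, k(p − 1) steps back are k steps forward
      j = k * p ∸ k
      back : iter α⁻¹ j i ≡ iter α k i
      back = begin
        iter α⁻¹ j i                       ≡⟨ cong (iter α⁻¹ j) (iter-* α periodic k) ⟨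
        iter α⁻¹ j (iter α (k * p) i)      ≡⟨ cong (λ m → iter α⁻¹ j (iter α m i)) (m+[n∸m]≡n (m≤m*n k p)) ⟨
        iter α⁻¹ j (iter α (k + j) i)      ≡⟨ cong (iter α⁻¹ j) (iter-+ α k j i) ⟩
        iter α⁻¹ j (iter α j (iter α k i)) ≡⟨ iter-cancel α (λ _ → inverseˡ π) j _ ⟩
        iter α k i                         ∎

    -- If α⁻¹ leaves E after k + 1 ≤ s steps from y, then w = α⁻¹ᵏ y is an α-entry point
    -- of E from which k + 1 steps of α lead to z ∉ E.
    stable-inverse : ∀ {s} → Stable (sysX n π E) s → Stable (sysXinv n π E) s
    stable-inverse {s} stable y z α⁻¹z≡y Ez Ey = run
      where
      run : ∀ k → k ≤ s → E (iter α⁻¹ k y) ≡ true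
      run zero    _     = Ey
      run (suc k) k+1≤s with E (iter α⁻¹ (suc k) y) in Ew′
      ... | true  = refl
      ... | false = contradiction (trans (sym (trans (cong E (sym αᵏ⁺¹w≡z)) reaches)) Ez) λ ()
        where
        w = iter α⁻¹ k y
        αw′≡w : α (iter α⁻¹ (suc k) y) ≡ w
        αw′≡w = trans (cong α (iter-suc α⁻¹ k y)) (inverseʳ π)
        reaches : E (iter α (suc k) w) ≡ true
        reaches = stable w (iter α⁻¹ (suc k) y) αw′≡w Ew′ (run k (≤-trans (n≤1+n k) k+1≤s)) (suc k) k+1≤s
        αᵏ⁺¹w≡z : iter α (suc k) w ≡ z
        αᵏ⁺¹w≡z = begin
          iter α (suc k) w ≡⟨ iter-suc α k w ⟩
          α (iter α k w)   ≡⟨ cong α (iter-cancel α⁻¹ (λ _ → inverseʳ π) k y) ⟩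
          α y              ≡⟨ cong α α⁻¹z≡y ⟨
          α (α⁻¹ z)        ≡⟨ inverseʳ π ⟩
          z                ∎

Path : ∀ {n} → Permutation′ n → (Fin n → Bool) → ℕ → (ℕ → Fin n) → Set
Path π E k i = (∀ u → u ≤ k → π ⟨$⟩ʳ i (suc u) ≡ i u)
             × E (i 0) ≡ true × E (i (suc k)) ≡ true × (∀ u → 1 ≤ u → u ≤ k → E (i u) ≡ false)

path-reverse : ∀ {n} {π : Permutation′ n} {E k i} → Path π E k i → Path (invPerm π) E k (λ v → i (suc k ∸ v))
path-reverse {π = π} {E} {k} {i} (steps , E₀ , Eₖ₊₁ , inside) = steps⁻¹ , Eₖ₊₁ , E-end , inside⁻¹
  where
  steps⁻¹ : ∀ v → v ≤ k → π ⟨$⟩ˡ i (k ∸ v) ≡ i (suc k ∸ v)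
  steps⁻¹ v v≤k = begin
    π ⟨$⟩ˡ i (k ∸ v)                 ≡⟨ cong (π ⟨$⟩ˡ_) (steps (k ∸ v) (m∸n≤m k v)) ⟨
    π ⟨$⟩ˡ (π ⟨$⟩ʳ i (suc (k ∸ v)))  ≡⟨ inverseˡ π ⟩
    i (suc (k ∸ v))                  ≡⟨ cong i (+-∸-assoc 1 v≤k) ⟨
    i (suc k ∸ v)                    ∎
  E-end : E (i (k ∸ k)) ≡ true
  E-end = subst (λ m → E (i m) ≡ true) (sym (n∸n≡0 k)) E₀
  inside⁻¹ : ∀ v → 1 ≤ v → v ≤ k → E (i (suc k ∸ v)) ≡ false
  inside⁻¹ v 1≤v v≤k = inside (suc k ∸ v) (m<n⇒0<n∸m (s≤s v≤k)) (∸-monoʳ-≤ (suc k) 1≤v)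

module Orbits {n : ℕ} (π : Permutation′ n) (E : Fin n → Bool) (bound : Bound (sysX n π E)) where

  private
    α α⁻¹ : Fin n → Fin n
    α   = π ⟨$⟩ʳ_
    α⁻¹ = π ⟨$⟩ˡ_

  X : Sys
  X = sysX n π E

  open ReachingTime X (bound⇒hits π E bound) public

  arrived-from-outside : ∀ k a → ((e X a ≡ᵇ k) ∧ not (E (α⁻¹ a))) ≡ (e X (α⁻¹ a) ≡ᵇ suc k)
  arrived-from-outside k a with E (α⁻¹ a) in E[α⁻¹a]
  ... | true  rewrite E⇒e≡0 E[α⁻¹a] = ∧-zeroʳ (e X a ≡ᵇ k)
  ... | false = begin
    (e X a ≡ᵇ k) ∧ true       ≡⟨ ∧-identityʳ (e X a ≡ᵇ k) ⟩
    (e X a ≡ᵇ k)              ≡⟨ cong (λ b → e X b ≡ᵇ k) (inverseʳ π) ⟨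
    (e X (α (α⁻¹ a)) ≡ᵇ k)    ≡⟨ cong (_≡ᵇ suc k) (e-step E[α⁻¹a]) ⟨
    (e X (α⁻¹ a) ≡ᵇ suc k)    ∎

  size-split : ∀ k → size X k ≡ pairCount X E (inMacro X k) + size X (suc k)
  size-split k = begin
    size X k
      ≡⟨ count-split (inMacro X k) (E ∘ α⁻¹) ⟩
    count (λ a → inMacro X k a ∧ E (α⁻¹ a)) (allFin n) + count (λ a → inMacro X k a ∧ not (E (α⁻¹ a))) (allFin n)
      ≡⟨ cong₂ _+_ from-E from-outside ⟩
    pairCount X E (inMacro X k) + size X (suc k)
      ∎
    where
    from-E : count (λ a → inMacro X k a ∧ E (α⁻¹ a)) (allFin n) ≡ pairCount X E (inMacro X k)
    from-E = trans (count-permute π (λ a → inMacro X k a ∧ E (α⁻¹ a)))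
      (count-cong (λ a → trans (cong (λ b → inMacro X k (α a) ∧ E b) (inverseˡ π)) (∧-comm (inMacro X k (α a)) (E a))) (allFin n))
    from-outside : count (λ a → inMacro X k a ∧ not (E (α⁻¹ a))) (allFin n) ≡ size X (suc k)
    from-outside = trans (count-cong (arrived-from-outside k) (allFin n))
      (sym (count-permute (invPerm π) (inMacro X (suc k))))

  pairCount≡ : ∀ k → pairCount X E (inMacro X k) ≡ size X k ∸ size X (suc k)
  pairCount≡ k = sym (trans (cong (_∸ size X (suc k)) (size-split k)) (m+n∸n≡m _ (size X (suc k))))

  imageRange⇒sizesDecrease : ImageRange X (Lmax X) → SizesDecrease X
  imageRange⇒sizesDecrease range = decreasing-from-steps shrinks
    where
    shrinks : ∀ k → suc k ≤ Lmax X → size X (suc k) < size X k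
    shrinks k k+1≤L with Equivalence.to (range k) (≤-trans (n≤1+n k) k+1≤L)
    ... | a , Ea , e[αa]≡k = subst (size X (suc k) <_) (sym (size-split k))
      (+-monoˡ-≤ (size X (suc k)) (count-pos (∈-allFin a) (cong₂ _∧_ Ea (≡⇒≡ᵇ≡true e[αa]≡k))))

  atLeast : ℕ → ℕ
  atLeast k = count (λ a → k ≤ᵇ e X a) (allFin n)

  size+atLeast : ∀ k → size X k + atLeast (suc k) ≡ atLeast k
  size+atLeast k = count-+ (inMacro X k) (λ a → suc k ≤ᵇ e X a) (λ a → k ≤ᵇ e X a)
    (λ a → 𝟙-≡ᵇ+<ᵇ (e X a) k)

  sum-e≡∑atLeast : sum (map (e X) (allFin n)) ≡ ∑[ k < card X ] atLeast (suc (toℕ k))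
  sum-e≡∑atLeast = layer-cake (e X) (λ a → <⇒≤ (e<card a))

  path-reachingTime : ∀ {k i} → Path π E k i → ∀ {u} → u ≤ k → e X (i u) ≡ u
  path-reachingTime {k} {i} (steps , E₀ , _ , inside) {u} u≤k = e-unique (i u) reaches before
    where
    walk : ∀ j m → j + m ≤ k → iter α j (i (j + m)) ≡ i m
    walk zero    m _       = refl
    walk (suc j) m j+m<k = trans (cong (iter α j) (steps (j + m) (<⇒≤ j+m<k))) (walk j m (<⇒≤ j+m<k))
    reaches : E (iter α u (i u)) ≡ true
    reaches = subst (λ v → E (iter α u (i v)) ≡ true) (+-identityʳ u)
      (trans (cong E (walk u 0 (subst (_≤ k) (sym (+-identityʳ u)) u≤k))) E₀)
    before : ∀ j → j < u → E (iter α j (i u)) ≡ false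
    before j j<u = begin
      E (iter α j (i u))             ≡⟨ cong (λ v → E (iter α j (i v))) (m+[n∸m]≡n (<⇒≤ j<u)) ⟨
      E (iter α j (i (j + (u ∸ j)))) ≡⟨ cong E (walk j (u ∸ j) (subst (_≤ k) (sym (m+[n∸m]≡n (<⇒≤ j<u))) u≤k)) ⟩
      E (i (u ∸ j))                  ≡⟨ inside (u ∸ j) (m<n⇒0<n∸m j<u) (≤-trans (m∸n≤m u j) u≤k) ⟩
      false                          ∎

-- Time reversal: (X, α) against (X, α⁻¹)

module Reversal {n : ℕ} (π : Permutation′ n) (E : Fin n → Bool) (bound : Bound (sysX n π E)) where

  private
    α α⁻¹ : Fin n → Fin n
    α   = π ⟨$⟩ʳ_
    α⁻¹ = π ⟨$⟩ˡ_

  X X⁻ : Sys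
  X  = sysX n π E
  X⁻ = sysXinv n π E

  module F = Orbits π E bound
  module B = Orbits (invPerm π) E (bound-inverse π E bound)

  <e⇔<e⁻ : ∀ {k y} → k < e X y ⇔ k < e X⁻ (iter α k y)
  <e⇔<e⁻ {k} {y} = mk⇔
    (λ k<e → Equivalence.from B.<e⇔avoids λ j j≤k →
      trans (cong E (iter-∸ α (λ _ → inverseˡ π) y j≤k)) (Equivalence.to F.<e⇔avoids k<e (k ∸ j) (m∸n≤m k j)))
    (λ k<e⁻ → Equivalence.from F.<e⇔avoids λ j j≤k →
      trans (cong E (sym (trans (iter-∸ α (λ _ → inverseˡ π) y (m∸n≤m k j)) (cong (λ m → iter α m y) (m∸[m∸n]≡n j≤k)))))
            (Equivalence.to B.<e⇔avoids k<e⁻ (k ∸ j) (m∸n≤m k j)))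

  atLeast-reverse : ∀ k → F.atLeast k ≡ B.atLeast k
  atLeast-reverse zero    = refl
  atLeast-reverse (suc k) = begin
    count (λ y → k <ᵇ e X y) (allFin n)                   ≡⟨ count-cong (λ y → <ᵇ-cong <e⇔<e⁻) (allFin n) ⟩
    count (λ y → k <ᵇ e X⁻ (iter α k y)) (allFin n)       ≡⟨ count-permute (iterate π k) (λ y → k <ᵇ e X⁻ y) ⟨
    count (λ y → k <ᵇ e X⁻ y) (allFin n)                  ∎

  size-reverse : ∀ k → size X⁻ k ≡ size X k
  size-reverse k = +-cancelʳ-≡ (F.atLeast (suc k)) (size X⁻ k) (size X k) (begin
    size X⁻ k + F.atLeast (suc k)  ≡⟨ cong (size X⁻ k +_) (atLeast-reverse (suc k)) ⟩
    size X⁻ k + B.atLeast (suc k)  ≡⟨ B.size+atLeast k ⟩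
    B.atLeast k                    ≡⟨ atLeast-reverse k ⟨
    F.atLeast k                    ≡⟨ F.size+atLeast k ⟨
    size X k + F.atLeast (suc k)   ∎)

  sum-e-reverse : sum (map (e X) (allFin n)) ≡ sum (map (e X⁻) (allFin n))
  sum-e-reverse = begin
    sum (map (e X) (allFin n))                  ≡⟨ F.sum-e≡∑atLeast ⟩
    ∑[ k < card X ] F.atLeast (suc (toℕ k))     ≡⟨ sum-cong-≗ (λ (k : Fin (card X)) → atLeast-reverse (suc (toℕ k))) ⟩
    ∑[ k < card X ] B.atLeast (suc (toℕ k))     ≡⟨ B.sum-e≡∑atLeast ⟨
    sum (map (e X⁻) (allFin n))                 ∎

  Lmax-≤ : Lmax X ≤ Lmax X⁻
  Lmax-≤ = Lmax-lub X bounded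
    where
    bounded : ∀ y → e X y ≤ Lmax X⁻
    bounded y with e X y in e[y]
    ... | zero  = z≤n
    ... | suc k = <-≤-trans (Equivalence.to <e⇔<e⁻ (subst (k <_) (sym e[y]) ≤-refl)) (e≤Lmax X⁻ (∈-allFin _))

  -- the orbit leaves E at a and re-enters it at αᵏ⁺¹ a
  entering-reverse : ∀ {k} → ∃[ a ] (E a ≡ true × e X (α a) ≡ k) → ∃[ b ] (E b ≡ true × e X⁻ (α⁻¹ b) ≡ k)
  entering-reverse {k} (a , Ea , e[αa]≡k) = iter α (suc k) a , E-exit , (begin
    e X⁻ (α⁻¹ (iter α (suc k) a))  ≡⟨ cong (e X⁻ ∘ α⁻¹) (iter-suc α k a) ⟩
    e X⁻ (α⁻¹ (α (iter α k a)))    ≡⟨ cong (e X⁻) (inverseˡ π) ⟩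
    e X⁻ (iter α k a)              ≡⟨ B.e-unique (iter α k a) E-start before ⟩
    k                              ∎)
    where
    E-exit : E (iter α k (α a)) ≡ true
    E-exit = subst (λ m → E (iter α m (α a)) ≡ true) e[αa]≡k (F.e-reaches (α a))
    E-start : E (iter α⁻¹ k (iter α k a)) ≡ true
    E-start = trans (cong E (iter-cancel α (λ _ → inverseˡ π) k a)) Ea
    before : ∀ j → j < k → E (iter α⁻¹ j (iter α k a)) ≡ false
    before j j<k = begin
      E (iter α⁻¹ j (iter α k a))      ≡⟨ cong E (iter-∸ α (λ _ → inverseˡ π) a (<⇒≤ j<k)) ⟩
      E (iter α (k ∸ j) a)             ≡⟨ cong (λ m → E (iter α m a)) (+-∸-assoc 1 j<k) ⟩
      E (iter α (k ∸ suc j) (α a))     ≡⟨ F.e-least (α a) (subst (k ∸ suc j <_) (sym e[αa]≡k) (∸-monoʳ-< z<s j<k)) ⟩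
      false                            ∎

  path-reachingTimes : ∀ {k i} → Path π E k i → ∀ {u} → 1 ≤ u → u ≤ k →
                       e X (i u) ≡ u × e X⁻ (i u) ≡ k ∸ u + 1
  path-reachingTimes {k} {i} path {u} 1≤u u≤k = F.path-reachingTime path u≤k , (begin
    e X⁻ (i u)                        ≡⟨ cong (e X⁻ ∘ i) (m∸[m∸n]≡n (m≤n⇒m≤1+n u≤k)) ⟨
    e X⁻ (i (suc k ∸ (suc k ∸ u)))    ≡⟨ B.path-reachingTime (path-reverse {π = π} {E} path) (∸-monoʳ-≤ (suc k) 1≤u) ⟩
    suc k ∸ u                         ≡⟨ +-∸-assoc 1 u≤k ⟩
    suc (k ∸ u)                       ≡⟨ +-comm 1 (k ∸ u) ⟩
    k ∸ u + 1                         ∎)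

-- The doubled system X̂ = X × {−1, 1}

module Doubled {n : ℕ} (π : Permutation′ n) (E : Fin n → Bool) (bound : Bound (sysX n π E)) where

  private
    α α⁻¹ : Fin n → Fin n
    α   = π ⟨$⟩ʳ_
    α⁻¹ = π ⟨$⟩ˡ_
    α̂ : Hat n → Hat n
    α̂ = hatαfun π

  X X⁻ H : Sys
  X  = sysX n π E
  X⁻ = sysXinv n π E
  H  = sysHat n π E

  module R  = Reversal π E bound
  -- invPerm (invPerm π) acts as π definitionally, so R⁻ compares X⁻ with X itself
  module R⁻ = Reversal (invPerm π) E (bound-inverse π E bound)
  module F  = R.F
  module B  = R.B

  reversible : Reversible (hatα π) r
  reversible = (λ { (i , s) → cong (i ,_) (not-involutive s) }) , λ { (i , true) → refl ; (i , false) → refl }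

  iter-α̂-true : ∀ k i → iter α̂ k (i , true) ≡ (iter α k i , true)
  iter-α̂-true zero    i = refl
  iter-α̂-true (suc k) i = iter-α̂-true k (α i)

  iter-α̂-false : ∀ k i → iter α̂ k (i , false) ≡ (iter α⁻¹ k i , false)
  iter-α̂-false zero    i = refl
  iter-α̂-false (suc k) i = iter-α̂-false k (α⁻¹ i)

  ∈-hatEl : ∀ x → x ∈ hatEl n
  ∈-hatEl (i , true)  = ∈-++⁺ˡ (∈-map⁺ (_, true) (∈-allFin i))
  ∈-hatEl (i , false) = ∈-++⁺ʳ (map (_, true) (allFin n)) (∈-map⁺ (_, false) (∈-allFin i))

  sum-map-hatEl : ∀ (h : Hat n → ℕ) →
    sum (map h (hatEl n)) ≡ sum (map (λ i → h (i , true)) (allFin n)) + sum (map (λ i → h (i , false)) (allFin n))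
  sum-map-hatEl h = begin
    sum (map h (hatEl n))
      ≡⟨ cong sum (map-++ h (map (_, true) (allFin n)) (map (_, false) (allFin n))) ⟩
    sum (map h (map (_, true) (allFin n)) ++ map h (map (_, false) (allFin n)))
      ≡⟨ sum-++ (map h (map (_, true) (allFin n))) (map h (map (_, false) (allFin n))) ⟩
    sum (map h (map (_, true) (allFin n))) + sum (map h (map (_, false) (allFin n)))
      ≡⟨ cong₂ _+_ (cong sum (map-∘ (allFin n))) (cong sum (map-∘ (allFin n))) ⟨
    sum (map (λ i → h (i , true)) (allFin n)) + sum (map (λ i → h (i , false)) (allFin n))
      ∎

  count-hatEl : ∀ (p : Hat n → Bool) →
    count p (hatEl n) ≡ count (λ i → p (i , true)) (allFin n) + count (λ i → p (i , false)) (allFin n)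
  count-hatEl p = begin
    count p (hatEl n)            ≡⟨ count≡sum-map p (hatEl n) ⟩
    sum (map (𝟙 ∘ p) (hatEl n))  ≡⟨ sum-map-hatEl (𝟙 ∘ p) ⟩
    sum (map (λ i → 𝟙 (p (i , true))) (allFin n)) + sum (map (λ i → 𝟙 (p (i , false))) (allFin n))
      ≡⟨ cong₂ _+_ (count≡sum-map (λ i → p (i , true)) (allFin n)) (count≡sum-map (λ i → p (i , false)) (allFin n)) ⟨
    count (λ i → p (i , true)) (allFin n) + count (λ i → p (i , false)) (allFin n)
      ∎

  count-hatEl-twice : ∀ {p : Hat n → Bool} {q : Fin n → Bool} → (∀ i → p (i , true) ≡ q i) →
    count (λ i → p (i , false)) (allFin n) ≡ count q (allFin n) →
    count p (hatEl n) ≡ count q (allFin n) + count q (allFin n)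
  count-hatEl-twice {p} p-true #p-false = trans (count-hatEl p) (cong₂ _+_ (count-cong p-true (allFin n)) #p-false)

  card-hat : card H ≡ card X + card X
  card-hat = trans (length-++ (map (_, true) (allFin n)))
    (cong₂ _+_ (length-map (_, true) (allFin n)) (length-map (_, false) (allFin n)))

  ratio-hat : ∀ {a} c → a ≡ c + c → a * card X ≡ c * card H
  ratio-hat c refl = begin
    (c + c) * card X            ≡⟨ *-distribʳ-+ (card X) c c ⟩
    c * card X + c * card X     ≡⟨ *-distribˡ-+ c (card X) (card X) ⟨
    c * (card X + card X)       ≡⟨ cong (c *_) card-hat ⟨
    c * card H                  ∎

  bound-hat : Bound H
  bound-hat (i , true)  = let k , hit = bound i in k , trans (cong (hatE E) (iter-α̂-true k i)) hit
  bound-hat (i , false) = let k , hit = bound-inverse π E bound i in k , trans (cong (hatE E) (iter-α̂-false k i)) hit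

  hits-hat : HitsWithinCard H
  hits-hat (i , true)  = let k , k<card , hit = bound⇒hits π E bound i in
    k , <-≤-trans k<card card≤ , trans (cong (hatE E) (iter-α̂-true k i)) hit
    where card≤ = subst (card X ≤_) (sym card-hat) (m≤m+n (card X) (card X))
  hits-hat (i , false) = let k , k<card , hit = bound⇒hits (invPerm π) E (bound-inverse π E bound) i in
    k , <-≤-trans k<card card≤ , trans (cong (hatE E) (iter-α̂-false k i)) hit
    where card≤ = subst (card X ≤_) (sym card-hat) (m≤m+n (card X) (card X))

  module Ĥ = ReachingTime H hits-hat

  e-hat-true : ∀ i → e H (i , true) ≡ e X i
  e-hat-true i = Ĥ.e-unique (i , true)
    (trans (cong (hatE E) (iter-α̂-true (e X i) i)) (F.e-reaches i))
    (λ j j<e → trans (cong (hatE E) (iter-α̂-true j i)) (F.e-least i j<e))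

  e-hat-false : ∀ i → e H (i , false) ≡ e X⁻ i
  e-hat-false i = Ĥ.e-unique (i , false)
    (trans (cong (hatE E) (iter-α̂-false (e X⁻ i) i)) (B.e-reaches i))
    (λ j j<e → trans (cong (hatE E) (iter-α̂-false j i)) (B.e-least i j<e))

  e-hat⇔ : ∀ k i s → (e H (i , s) ≡ k ⇔ ((s ≡ true × e X i ≡ k) ⊎ (s ≡ false × e X⁻ i ≡ k)))
  e-hat⇔ k i true  = mk⇔ (λ e≡k → inj₁ (refl , trans (sym (e-hat-true i)) e≡k))
    λ { (inj₁ (_ , e≡k)) → trans (e-hat-true i) e≡k ; (inj₂ (() , _)) }
  e-hat⇔ k i false = mk⇔ (λ e≡k → inj₂ (refl , trans (sym (e-hat-false i)) e≡k))
    λ { (inj₂ (_ , e≡k)) → trans (e-hat-false i) e≡k ; (inj₁ (() , _)) }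

  size-hat : ∀ k → size H k ≡ 2 * size X k
  size-hat k = begin
    size H k
      ≡⟨ count-hatEl (inMacro H k) ⟩
    count (λ i → e H (i , true) ≡ᵇ k) (allFin n) + count (λ i → e H (i , false) ≡ᵇ k) (allFin n)
      ≡⟨ cong₂ _+_ (count-cong (λ i → cong (_≡ᵇ k) (e-hat-true i)) (allFin n))
                   (count-cong (λ i → cong (_≡ᵇ k) (e-hat-false i)) (allFin n)) ⟩
    size X k + size X⁻ k
      ≡⟨ cong (size X k +_) (R.size-reverse k) ⟩
    size X k + size X k
      ≡⟨ m+m≡2*m (size X k) ⟩
    2 * size X k
      ∎

  Lmax-inverse : Lmax X⁻ ≡ Lmax X
  Lmax-inverse = ≤-antisym R⁻.Lmax-≤ R.Lmax-≤

  Lmax-hat : Lmax H ≡ Lmax X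
  Lmax-hat = ≤-antisym
    (Lmax-lub H λ { (i , true)  → subst (_≤ Lmax X) (sym (e-hat-true i)) (e≤Lmax X (∈-allFin i))
                  ; (i , false) → subst₂ _≤_ (sym (e-hat-false i)) Lmax-inverse (e≤Lmax X⁻ (∈-allFin i)) })
    (Lmax-lub X λ i → subst (_≤ Lmax H) (e-hat-true i) (e≤Lmax H (∈-hatEl (i , true))))

  stable-hat : ∀ s → Stable H s ⇔ Stable X s
  stable-hat s = mk⇔ restrict extend
    where
    restrict : Stable H s → Stable X s
    restrict stable y z αz≡y Ez Ey k k≤s = trans (cong (hatE E) (sym (iter-α̂-true k y)))
      (stable (y , true) (z , true) (cong (_, true) αz≡y) Ez Ey k k≤s)
    extend : Stable X s → Stable H s
    extend stable (y , _) (z , true)  refl Ez Ey k k≤s =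
      trans (cong (hatE E) (iter-α̂-true k (α z))) (stable (α z) z refl Ez Ey k k≤s)
    extend stable (y , _) (z , false) refl Ez Ey k k≤s =
      trans (cong (hatE E) (iter-α̂-false k (α⁻¹ z))) (stable-inverse π E stable (α⁻¹ z) z refl Ez Ey k k≤s)

  path-hat : ∀ {s k i} → HatPath π E s k i → ∀ {u} → 1 ≤ u → u ≤ k →
             e H (i u , s) ≡ u × e H (r (i u , s)) ≡ k ∸ u + 1
  path-hat {true} (steps , ends) 1≤u u≤k =
    let forward , backward = R.path-reachingTimes ((λ v v≤k → cong proj₁ (steps v v≤k)) , ends) 1≤u u≤k
    in trans (e-hat-true _) forward , trans (e-hat-false _) backward
  path-hat {false} (steps , ends) 1≤u u≤k =
    let forward , backward = R⁻.path-reachingTimes ((λ v v≤k → cong proj₁ (steps v v≤k)) , ends) 1≤u u≤k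
    in trans (e-hat-false _) forward , trans (e-hat-true _) backward

  path-entropy : ∀ s k i → HatPath π E s k i → ∀ u → 1 ≤ u → u ≤ k →
    (msize H (r (i u , s)) ≡ msize H (i u , s) ⇔ size X u ≡ size X (k ∸ u + 1))
  path-entropy s k i path u 1≤u u≤k = mk⇔
    (λ same → sym (*-cancelˡ-≡ _ _ 2 (trans (sym backward) (trans same forward))))
    (λ same → trans backward (trans (cong (2 *_) (sym same)) (sym forward)))
    where
    forward : msize H (i u , s) ≡ 2 * size X u
    forward = trans (cong (size H) (proj₁ (path-hat path 1≤u u≤k))) (size-hat u)
    backward : msize H (r (i u , s)) ≡ 2 * size X (k ∸ u + 1)
    backward = trans (cong (size H) (proj₂ (path-hat path 1≤u u≤k))) (size-hat (k ∸ u + 1))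

  entering-hat⇔ : ∀ k → (∃[ x ] (hatE E x ≡ true × e H (α̂ x) ≡ k)) ⇔ (∃[ a ] (E a ≡ true × e X (α a) ≡ k))
  entering-hat⇔ k = mk⇔ to λ (a , Ea , e≡k) → (a , true) , Ea , trans (e-hat-true (α a)) e≡k
    where
    to : ∃[ x ] (hatE E x ≡ true × e H (α̂ x) ≡ k) → ∃[ a ] (E a ≡ true × e X (α a) ≡ k)
    to ((a , true)  , Ea , e≡k) = a , Ea , trans (sym (e-hat-true (α a))) e≡k
    to ((a , false) , Ea , e≡k) = R⁻.entering-reverse (a , Ea , trans (sym (e-hat-false (α⁻¹ a))) e≡k)

  imageRange-hat : ImageRange X (Lmax X) ⇔ ImageRange H (Lmax X)
  imageRange-hat = mk⇔ (λ range k → ⇔-sym (entering-hat⇔ k) ⇔-∘ range k)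
                       (λ range k → entering-hat⇔ k ⇔-∘ range k)

  module Equilibrium (range : ImageRange X (Lmax X)) where

    decreasing-X : SizesDecrease X
    decreasing-X = F.imageRange⇒sizesDecrease range

    decreasing-H : SizesDecrease H
    decreasing-H j k j<k k≤L = subst₂ _<_ (sym (size-hat k)) (sym (size-hat j))
      (*-monoʳ-< 2 (decreasing-X j k j<k (subst (k ≤_) Lmax-hat k≤L)))

    module Xₑ = F.Entropy ∈-allFin decreasing-X
    module Hₑ = Ĥ.Entropy ∈-hatEl decreasing-H

    Neq≡ : ∀ x → Neq H x ≡ not (hatE E x)
    Neq≡ x = cong not (Hₑ.Eq≡E x)

    Dset≡ : ∀ x → Dset H x ≡ (Eq H x ∧ Neq H (α̂ x))
    Dset≡ x = trans (Hₑ.Dset≡ x) (sym (cong₂ _∧_ (Hₑ.Eq≡E x) (Neq≡ (α̂ x))))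

    Neq-increasing : ∀ x → Neq H x ≡ true → msize H x < msize H (α̂ x)
    Neq-increasing x neq = Hₑ.msize-increasing (not-injective (trans (sym (Neq≡ x)) neq))

    pairCount-Eq : ∀ k → pairCount H (Eq H) (inMacro H k) ≡ 2 * (size X k ∸ size X (suc k))
    pairCount-Eq k = begin
      pairCount H (Eq H) (inMacro H k)
        ≡⟨ count-hatEl (λ y → Eq H y ∧ inMacro H k (α̂ y)) ⟩
      count (λ i → Eq H (i , true) ∧ (e H (α i , true) ≡ᵇ k)) (allFin n)
        + count (λ i → Eq H (i , false) ∧ (e H (α⁻¹ i , false) ≡ᵇ k)) (allFin n)
        ≡⟨ cong₂ _+_
             (count-cong (λ i → cong₂ _∧_ (Hₑ.Eq≡E (i , true)) (cong (_≡ᵇ k) (e-hat-true (α i)))) (allFin n))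
             (count-cong (λ i → cong₂ _∧_ (Hₑ.Eq≡E (i , false)) (cong (_≡ᵇ k) (e-hat-false (α⁻¹ i)))) (allFin n)) ⟩
      pairCount X E (inMacro X k) + pairCount X⁻ E (inMacro X⁻ k)
        ≡⟨ cong₂ _+_ (F.pairCount≡ k) (B.pairCount≡ k) ⟩
      (size X k ∸ size X (suc k)) + (size X⁻ k ∸ size X⁻ (suc k))
        ≡⟨ cong₂ (λ a b → (size X k ∸ size X (suc k)) + (a ∸ b)) (R.size-reverse k) (R.size-reverse (suc k)) ⟩
      (size X k ∸ size X (suc k)) + (size X k ∸ size X (suc k))
        ≡⟨ m+m≡2*m (size X k ∸ size X (suc k)) ⟩
      2 * (size X k ∸ size X (suc k))
        ∎

    path-midpoint : ∀ s k i → HatPath π E s k i → ∀ u → 1 ≤ u → u ≤ k →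
      (msize H (r (i u , s)) ≡ msize H (i u , s) ⇔ 2 * u ≡ k + 1)
    path-midpoint s k i path u 1≤u u≤k =
      midpoint u≤k ⇔-∘ (mk⇔ (antitone-injective decreasing-X (bounded forward) (bounded backward)) (cong (size X))
                    ⇔-∘ path-entropy s k i path u 1≤u u≤k)
      where
      forward  = proj₁ (path-hat path 1≤u u≤k)
      backward = proj₂ (path-hat path 1≤u u≤k)
      bounded : ∀ {x m} → e H x ≡ m → m ≤ Lmax X
      bounded {x} e≡m = subst₂ _≤_ e≡m Lmax-hat (e≤Lmax H (∈-hatEl x))

    Dset-ratio : count (Dset H) (hatEl n) * card X ≡ count (Dset X) (allFin n) * card H
    Dset-ratio = ratio-hat (count (Dset X) (allFin n)) (count-hatEl-twice (λ i → trans (Hₑ.Dset≡ (i , true)) (sym (Xₑ.Dset≡ i))) (begin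
      count (λ i → Dset H (i , false)) (allFin n)      ≡⟨ count-cong (λ i → Hₑ.Dset≡ (i , false)) (allFin n) ⟩
      count (λ i → E i ∧ not (E (α⁻¹ i))) (allFin n)   ≡⟨ exits≡entries π E ⟨
      count (λ i → E i ∧ not (E (α i))) (allFin n)     ≡⟨ count-cong (sym ∘ Xₑ.Dset≡) (allFin n) ⟩
      count (Dset X) (allFin n)                        ∎))

    Iset-ratio : count (Iset H) (hatEl n) * card X ≡ count (Iset X) (allFin n) * card H
    Iset-ratio = ratio-hat (count (Iset X) (allFin n)) (count-hatEl-twice (λ i → trans (Hₑ.Iset≡ (i , true)) (sym (Xₑ.Iset≡ i)))
      (count-cong (λ i → trans (Hₑ.Iset≡ (i , false)) (sym (Xₑ.Iset≡ i))) (allFin n)))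

    Cset-ratio : count (Cset H) (hatEl n) * card X ≡ count (Cset X) (allFin n) * card H
    Cset-ratio = ratio-hat (count (Cset X) (allFin n)) (count-hatEl-twice (λ i → trans (Hₑ.Cset≡ (i , true)) (sym (Xₑ.Cset≡ i))) (begin
      count (λ i → Cset H (i , false)) (allFin n)      ≡⟨ count-cong (λ i → Hₑ.Cset≡ (i , false)) (allFin n) ⟩
      count (λ i → E i ∧ E (α⁻¹ i)) (allFin n)         ≡⟨ count-∧-shift π E E ⟨
      count (λ i → E i ∧ E (α i)) (allFin n)           ≡⟨ count-cong (sym ∘ Xₑ.Cset≡) (allFin n) ⟩
      count (Cset X) (allFin n)                        ∎))

    sum𝒜-ratio : sum𝒜 H * card X ≡ sum𝒜 X * card H
    sum𝒜-ratio = ratio-hat (sum𝒜 X) (begin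
      sum (map (𝒜 H) (hatEl n))
        ≡⟨ sum-map-hatEl (𝒜 H) ⟩
      sum (map (λ i → 𝒜 H (i , true)) (allFin n)) + sum (map (λ i → 𝒜 H (i , false)) (allFin n))
        ≡⟨ cong₂ _+_ (cong sum (map-cong (λ i → trans (Hₑ.𝒜≡e (i , true)) (e-hat-true i)) (allFin n)))
                     (cong sum (map-cong (λ i → trans (Hₑ.𝒜≡e (i , false)) (e-hat-false i)) (allFin n))) ⟩
      sum (map (e X) (allFin n)) + sum (map (e X⁻) (allFin n))
        ≡⟨ cong (sum (map (e X) (allFin n)) +_) R.sum-e-reverse ⟨
      sum (map (e X) (allFin n)) + sum (map (e X) (allFin n))
        ≡⟨ cong₂ _+_ sum-e≡sum𝒜 sum-e≡sum𝒜 ⟩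
      sum𝒜 X + sum𝒜 X
        ∎)
      where
      sum-e≡sum𝒜 : sum (map (e X) (allFin n)) ≡ sum𝒜 X
      sum-e≡sum𝒜 = cong sum (map-cong (sym ∘ Xₑ.𝒜≡e) (allFin n))

theorem31 : (n : ℕ) (π : Permutation′ n) (E : Fin n → Bool) →
    Bound (sysX n π E) →
    let X = sysX n π E
        X⁻ = sysXinv n π E
        H = sysHat n π E
    in
    -- (X̂, α̂, r) is reversible and Ê-bound
    (Reversible (hatα π) r × Bound H)
    -- (a)
    × ((∀ x → hatE E (r x) ≡ hatE E x)
       × (∀ s → (Stable H s ⇔ Stable X s))
       × Lmax H ≡ Lmax X
       × Lmax X⁻ ≡ Lmax X
       × (∀ k i s → (e H (i , s) ≡ k ⇔ ((s ≡ true × e X i ≡ k) ⊎ (s ≡ false × e X⁻ i ≡ k))))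
       × (∀ k → size H k ≡ 2 * size X k))
    -- (b)
    × (∀ s k i → HatPath π E s k i → ∀ u → 1 ≤ u → u ≤ k →
         (msize H (r (i u , s)) ≡ msize H (i u , s) ⇔ size X u ≡ size X (k ∸ u + 1)))
    -- (c)
    × (ImageRange X (Lmax X) ⇔ ImageRange H (Lmax X))
    -- (d)
    × (ImageRange X (Lmax X) →
         (∀ x → Eq H x ≡ hatE E x)
         × (∀ x → Neq H x ≡ not (hatE E x))
         × (∀ x → Dset H x ≡ (Eq H x ∧ Neq H (hatαfun π x)))
         × (∀ x → Neq H x ≡ true → msize H x < msize H (hatαfun π x))
         × (∀ k → k ≤ Lmax X →
              pairCount H (Eq H) (inMacro H k) ≡ 2 * (size X k ∸ size X (suc k)))
         × (∀ s k i → HatPath π E s k i → ∀ u → 1 ≤ u → u ≤ k →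
              (msize H (r (i u , s)) ≡ msize H (i u , s) ⇔ 2 * u ≡ k + 1))
         × count (Dset H) (hatEl n) * card X ≡ count (Dset X) (allFin n) * card H
         × count (Iset H) (hatEl n) * card X ≡ count (Iset X) (allFin n) * card H
         × count (Cset H) (hatEl n) * card X ≡ count (Cset X) (allFin n) * card H
         × sum𝒜 H * card X ≡ sum𝒜 X * card H)
theorem31 n π E bound =
    (reversible , bound-hat)
  , ((λ _ → refl) , stable-hat , Lmax-hat , Lmax-inverse , e-hat⇔ , size-hat)
  , path-entropy
  , imageRange-hat
  , λ range → let open Equilibrium range in
      Hₑ.Eq≡E , Neq≡ , Dset≡ , Neq-increasing , (λ k _ → pairCount-Eq k) , path-midpoint
    , Dset-ratio , Iset-ratio , Cset-ratio , sum𝒜-ratio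
  where open Doubled π E bound
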